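{- Let $r\ge2$, $n=2^r$, $M=2^{n-r}$, $\nu=2^{r-1}-1$. (1) If $\hat{\mathcal{C}}$ is a zeroed diamond code of length $n+1$ with $2M$ codewords, then $A_0(\hat{\mathcal{C}})=A_{n+1}(\hat{\mathcal{C}})=1$ and $A_1(\hat{\mathcal{C}})=A_n(\hat{\mathcal{C}})=2$; for even $i>0$, $$A_i(\hat{\mathcal{C}})=\frac{\binom{n+1}{i}+(n-1)(\Delta_{i-1}+\Delta_i)}{n};$$ and for odd $i>1$, $A_i(\hat{\mathcal{C}})=A_{n+1-i}(\hat{\mathcal{C}})$, i.e., $$A_i(\hat{\mathcal{C}})=\frac{\binom{n+1}{i}+(n-1)(\Delta_{i-1}+\Delta_{i-2})}{n}.$$ (2) If $\hat{\mathcal{C}}$ is a non-zeroed diamond code of length $n+1$ with $2M$ codewords, then $A_0(\hat{\mathcal{C}})=0$ and $A_1(\hat{\mathcal{C}})=1$; for even $i>0$, $$A_i(\hat{\mathcal{C}})=\frac{\binom{n+1}{i}-(\Delta_i+\Delta_{i-1})}{n};$$ and for odd $i>1$, $$A_i(\hat{\mathcal{C}})=\frac{\binom{n+1}{i}-(\Delta_{i-1}+\Delta_{i-2})}{n}.$$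
   Context: All codes are binary; $A_i(\mathcal{C})$ is the number of codewords of $\mathcal{C}$ of Hamming weight $i$. A code is zeroed if it contains the all-zero word, non-zeroed otherwise. A diamond code of length $m$ is a code $\hat{\mathcal{C}}\subseteq\mathbb{F}_2^m$, nonempty with nonempty complement, such that every codeword has exactly $2$ codewords (and hence $m-2$ non-codewords) at Hamming distance $1$, and every non-codeword has exactly $1$ codeword (and hence $m-1$ non-codewords) at distance $1$. For integers $i\ge 0$: $\Delta_i=\binom{\nu}{\lfloor i/2\rfloor}$ if $i\equiv 0,3\pmod 4$ and $\Delta_i=-\binom{\nu}{\lfloor i/2\rfloor}$ if $i\equiv 1,2\pmod 4$ (with $\binom{a}{b}=0$ for $b>a$). -}

module Defs where

open import Data.Bool using (Bool; true; false; not; if_then_else_)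
open import Data.Nat using (ℕ; zero; suc; _+_; _*_; _∸_; _^_; _/_; _%_; _≡ᵇ_)
open import Data.Nat.Combinatorics using (_C_)
open import Data.Integer as ℤ using (ℤ; +_)
open import Data.Fin using (Fin)
open import Data.Vec using (Vec; []; _∷_; updateAt; replicate)
open import Data.List using (List; []; _∷_; map; _++_; allFin)
open import Data.Nat.ListAction using (sum)
open import Relation.Binary.PropositionalEquality using (_≡_)
open import Data.Product using (∃)

Word : ℕ → Set
Word m = Vec Bool m

allWords : (m : ℕ) → List (Word m)
allWords zero    = [] ∷ []
allWords (suc m) = map (false ∷_) (allWords m) ++ map (true ∷_) (allWords m)

Code : ℕ → Set
Code m = Word m → Bool

b2n : Bool → ℕ
b2n true  = 1
b2n false = 0

weight : {m : ℕ} → Word m → ℕ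
weight []       = 0
weight (b ∷ w)  = b2n b + weight w

size : {m : ℕ} → Code m → ℕ
size {m} 𝒞 = sum (map (λ w → b2n (𝒞 w)) (allWords m))

A : {m : ℕ} → Code m → ℕ → ℕ
A {m} 𝒞 i = sum (map (λ w → b2n (𝒞 w) * (if weight w ≡ᵇ i then 1 else 0)) (allWords m))

-- flip coordinate j (the words at Hamming distance 1 from w are exactly flip j w)
flip : {m : ℕ} → Fin m → Word m → Word m
flip j w = updateAt w j not

codeNeighbours : {m : ℕ} → Code m → Word m → ℕ
codeNeighbours {m} 𝒞 w = sum (map (λ j → b2n (𝒞 (flip j w))) (allFin m))

zeroWord : (m : ℕ) → Word m
zeroWord m = replicate m false

record IsDiamond {m : ℕ} (𝒞 : Code m) : Set where
  field
    nonempty      : ∃ λ w → 𝒞 w ≡ true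
    cononempty    : ∃ λ w → 𝒞 w ≡ false
    codewordNbrs  : ∀ w → 𝒞 w ≡ true  → codeNeighbours 𝒞 w ≡ 2
    noncodeNbrs   : ∀ w → 𝒞 w ≡ false → codeNeighbours 𝒞 w ≡ 1

Zeroed : {m : ℕ} → Code m → Set
Zeroed {m} 𝒞 = 𝒞 (zeroWord m) ≡ true

-- Δ_i with parameter ν (binomial is 0 when the lower index exceeds the upper one)
Δ : ℕ → ℕ → ℤ
Δ ν i with i % 4
... | 0 = + (ν C (i / 2))
... | 3 = + (ν C (i / 2))
... | _ = ℤ.- (+ (ν C (i / 2)))

¬Zeroed : {m : ℕ} → Code m → Set
¬Zeroed {m} 𝒞 = 𝒞 (zeroWord m) ≡ false

{-# OPTIONS --safe #-}
module Submission where

-- Counting in two ways the pairs (w, c) with w a word of weight i + 1 and c a codeword adjacent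
-- to w, where w has 1 + [w ∈ 𝒞] codeword neighbours, shows that the weight distribution of
-- every diamond code of length m satisfies
--   (i+2) A(i+2) + (m-i) A(i) = A(i+1) + C(m,i+1),   A(1) = A(0) + 1,
-- and a solution of this recurrence is determined by its first two values. For m = n + 1 = 2N + 1
-- the binomials C(m,i) solve the recurrence scaled by n, and (-1)^⌊i/2⌋ C(N,⌊i/2⌋) solves the
-- homogeneous one, so n A(i) = C(m,i) + (n A(0) - 1) (-1)^⌊i/2⌋ C(N,⌊i/2⌋). Pascal's rule turns
-- the last factor into Δ(i-1) + Δ(i) with ν = N - 1, and for even N it is invariant under
-- i ↦ m - i on odd i, which gives the symmetry.

open import Defs

module HammingCube where

  open import Data.Bool using (true; false; if_then_else_; T)
  open import Data.Unit using (tt)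
  open import Data.Nat using (ℕ; zero; suc; _+_; _*_; _∸_; _≤_; _≡ᵇ_; z≤n; s≤s)
  open import Data.Nat.Properties
  open import Algebra.Properties.CommutativeSemigroup +-commutativeSemigroup using (interchange)
  open import Data.Nat.Combinatorics using (_C_; nCk+nC[k+1]≡[n+1]C[k+1])
  open import Data.Nat.ListAction using (sum)
  open import Data.Nat.ListAction.Properties using (sum-++)
  open import Data.Nat.Tactic.RingSolver using (solve-∀)
  open import Data.Fin using (Fin; zero; suc)
  open import Data.Vec using ([]; _∷_)
  open import Data.List using (List; []; _∷_; map; _++_; allFin)
  open import Data.List.Properties using (map-++; map-∘; map-tabulate)
  open import Function using (_∘_)
  open import Relation.Binary.PropositionalEquality
  open ≡-Reasoning

  ∑ : {X : Set} → List X → (X → ℕ) → ℕ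
  ∑ xs f = sum (map f xs)

  infix 2 ∑
  syntax ∑ xs (λ x → e) = ∑[ x ← xs ] e

  ∑-cong : ∀ {X} {f g : X → ℕ} → (∀ x → f x ≡ g x) → ∀ xs → ∑ xs f ≡ ∑ xs g
  ∑-cong f≗g []       = refl
  ∑-cong f≗g (x ∷ xs) = cong₂ _+_ (f≗g x) (∑-cong f≗g xs)

  ∑-zero : ∀ {X} (xs : List X) → (∑[ _ ← xs ] 0) ≡ 0
  ∑-zero []       = refl
  ∑-zero (x ∷ xs) = ∑-zero xs

  ∑-+ : ∀ {X} (f g : X → ℕ) xs → (∑[ x ← xs ] (f x + g x)) ≡ ∑ xs f + ∑ xs g
  ∑-+ f g []       = refl
  ∑-+ f g (x ∷ xs) = trans (cong (f x + g x +_) (∑-+ f g xs)) (interchange (f x) (g x) (∑ xs f) (∑ xs g))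

  ∑-*ˡ : ∀ {X} c (f : X → ℕ) xs → (∑[ x ← xs ] (c * f x)) ≡ c * ∑ xs f
  ∑-*ˡ c f []       = sym (*-zeroʳ c)
  ∑-*ˡ c f (x ∷ xs) = trans (cong (c * f x +_) (∑-*ˡ c f xs)) (sym (*-distribˡ-+ c (f x) (∑ xs f)))

  ∑-swap : ∀ {X Y} (F : X → Y → ℕ) xs ys →
           (∑[ x ← xs ] ∑[ y ← ys ] F x y) ≡ (∑[ y ← ys ] ∑[ x ← xs ] F x y)
  ∑-swap F []       ys = sym (∑-zero ys)
  ∑-swap F (x ∷ xs) ys = trans (cong (∑ ys (F x) +_) (∑-swap F xs ys))
                               (sym (∑-+ (F x) (λ y → ∑[ x ← xs ] F x y) ys))

  ∑-++ : ∀ {X} (f : X → ℕ) xs ys → ∑ (xs ++ ys) f ≡ ∑ xs f + ∑ ys f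
  ∑-++ f xs ys = trans (cong sum (map-++ f xs ys)) (sum-++ (map f xs) (map f ys))

  ∑-map : ∀ {X Y} (f : X → ℕ) (g : Y → X) ys → ∑ (map g ys) f ≡ ∑ ys (f ∘ g)
  ∑-map f g ys = cong sum (sym (map-∘ ys))

  ∑-allFin-suc : ∀ m (g : Fin (suc m) → ℕ) → ∑ (allFin (suc m)) g ≡ g zero + ∑ (allFin m) (g ∘ suc)
  ∑-allFin-suc m g = cong (λ xs → g zero + sum xs)
    (trans (map-tabulate suc g) (sym (map-tabulate (λ j → j) (g ∘ suc))))

  ∑-allWords-suc : ∀ m (f : Word (suc m) → ℕ) →
    ∑ (allWords (suc m)) f ≡ (∑[ w ← allWords m ] f (false ∷ w)) + (∑[ w ← allWords m ] f (true ∷ w))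
  ∑-allWords-suc m f = begin
    ∑ (map (false ∷_) (allWords m) ++ map (true ∷_) (allWords m)) f
      ≡⟨ ∑-++ f (map (false ∷_) (allWords m)) (map (true ∷_) (allWords m)) ⟩
    ∑ (map (false ∷_) (allWords m)) f + ∑ (map (true ∷_) (allWords m)) f
      ≡⟨ cong₂ _+_ (∑-map f (false ∷_) (allWords m)) (∑-map f (true ∷_) (allWords m)) ⟩
    (∑[ w ← allWords m ] f (false ∷ w)) + (∑[ w ← allWords m ] f (true ∷ w)) ∎

  flip-involutive : ∀ {m} (j : Fin m) (w : Word m) → flip j (flip j w) ≡ w
  flip-involutive zero    (true  ∷ w) = refl
  flip-involutive zero    (false ∷ w) = refl
  flip-involutive (suc j) (b ∷ w)     = cong (b ∷_) (flip-involutive j w)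

  ∑-flip : ∀ m (j : Fin m) (h : Word m → ℕ) → (∑[ w ← allWords m ] h (flip j w)) ≡ ∑ (allWords m) h
  ∑-flip (suc m) zero h = begin
    (∑[ w ← allWords (suc m) ] h (flip zero w))                     ≡⟨ ∑-allWords-suc m (h ∘ flip zero) ⟩
    (∑[ w ← allWords m ] h (true ∷ w)) + (∑[ w ← allWords m ] h (false ∷ w))
      ≡⟨ +-comm (∑[ w ← allWords m ] h (true ∷ w)) _ ⟩
    (∑[ w ← allWords m ] h (false ∷ w)) + (∑[ w ← allWords m ] h (true ∷ w)) ≡⟨ ∑-allWords-suc m h ⟨
    ∑ (allWords (suc m)) h                                           ∎
  ∑-flip (suc m) (suc j) h = begin
    (∑[ w ← allWords (suc m) ] h (flip (suc j) w))
      ≡⟨ ∑-allWords-suc m (h ∘ flip (suc j)) ⟩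
    (∑[ w ← allWords m ] h (false ∷ flip j w)) + (∑[ w ← allWords m ] h (true ∷ flip j w))
      ≡⟨ cong₂ _+_ (∑-flip m j (h ∘ (false ∷_))) (∑-flip m j (h ∘ (true ∷_))) ⟩
    (∑[ w ← allWords m ] h (false ∷ w)) + (∑[ w ← allWords m ] h (true ∷ w)) ≡⟨ ∑-allWords-suc m h ⟨
    ∑ (allWords (suc m)) h                                           ∎

  neighbourSum : ∀ {m} → (Word m → ℕ) → Word m → ℕ
  neighbourSum {m} f w = ∑[ j ← allFin m ] f (flip j w)

  ∑-neighbourSum : ∀ m (f g : Word m → ℕ) →
    (∑[ w ← allWords m ] g w * neighbourSum f w) ≡ (∑[ w ← allWords m ] f w * neighbourSum g w)
  ∑-neighbourSum m f g = begin
    (∑[ w ← W ] g w * neighbourSum f w)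
      ≡⟨ ∑-cong (λ w → sym (∑-*ˡ (g w) (f ∘ flip′ w) (allFin m))) W ⟩
    (∑[ w ← W ] ∑[ j ← allFin m ] g w * f (flip j w)) ≡⟨ ∑-swap (λ w j → g w * f (flip j w)) W (allFin m) ⟩
    (∑[ j ← allFin m ] ∑[ w ← W ] g w * f (flip j w)) ≡⟨ ∑-cong reflect (allFin m) ⟩
    (∑[ j ← allFin m ] ∑[ w ← W ] f w * g (flip j w)) ≡⟨ ∑-swap (λ w j → f w * g (flip j w)) W (allFin m) ⟨
    (∑[ w ← W ] ∑[ j ← allFin m ] f w * g (flip j w)) ≡⟨ ∑-cong (λ w → ∑-*ˡ (f w) (g ∘ flip′ w) (allFin m)) W ⟩
    (∑[ w ← W ] f w * neighbourSum g w)        ∎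
    where
    W : List (Word m)
    W = allWords m
    flip′ : Word m → Fin m → Word m
    flip′ w j = flip j w
    reflect : ∀ j → (∑[ w ← W ] g w * f (flip j w)) ≡ (∑[ w ← W ] f w * g (flip j w))
    reflect j = begin
      (∑[ w ← W ] g w * f (flip j w))
        ≡⟨ ∑-cong (λ w → cong (λ v → g v * f (flip j w)) (flip-involutive j w)) W ⟨
      (∑[ w ← W ] g (flip j (flip j w)) * f (flip j w)) ≡⟨ ∑-flip m j (λ v → g (flip j v) * f v) ⟩
      (∑[ w ← W ] g (flip j w) * f w)                   ≡⟨ ∑-cong (λ w → *-comm (g (flip j w)) (f w)) W ⟩
      (∑[ w ← W ] f w * g (flip j w))                   ∎

  weight≤length : ∀ {m} (w : Word m) → weight w ≤ m
  weight≤length []          = z≤n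
  weight≤length (true  ∷ w) = s≤s (weight≤length w)
  weight≤length (false ∷ w) = m≤n⇒m≤1+n (weight≤length w)

  neighbourSum-weight : ∀ m (h : ℕ → ℕ) (w : Word m) →
    neighbourSum (h ∘ weight) w ≡ weight w * h (weight w ∸ 1) + (m ∸ weight w) * h (suc (weight w))
  neighbourSum-weight zero    h []          = refl
  neighbourSum-weight (suc m) h (true ∷ u)  = begin
    neighbourSum (h ∘ weight) (true ∷ u)                        ≡⟨ ∑-allFin-suc m _ ⟩
    h k + neighbourSum (h ∘ suc ∘ weight) u
      ≡⟨ cong (h k +_) (neighbourSum-weight m (h ∘ suc) u) ⟩
    h k + (k * h (suc (k ∸ 1)) + (m ∸ k) * h (suc (suc k)))
      ≡⟨ cong (λ x → h k + (x + (m ∸ k) * h (suc (suc k)))) (pred-cancel k) ⟩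
    h k + (k * h k + (m ∸ k) * h (suc (suc k)))                  ≡⟨ +-assoc (h k) _ _ ⟨
    suc k * h k + (m ∸ k) * h (suc (suc k))                      ∎
    where
    k : ℕ
    k = weight u
    pred-cancel : ∀ k → k * h (suc (k ∸ 1)) ≡ k * h k
    pred-cancel zero    = refl
    pred-cancel (suc k) = refl
  neighbourSum-weight (suc m) h (false ∷ u) = begin
    neighbourSum (h ∘ weight) (false ∷ u)                        ≡⟨ ∑-allFin-suc m _ ⟩
    h (suc k) + neighbourSum (h ∘ weight) u
      ≡⟨ cong (h (suc k) +_) (neighbourSum-weight m h u) ⟩
    h (suc k) + (k * h (k ∸ 1) + (m ∸ k) * h (suc k))
      ≡⟨ x+[y+z]≡y+[x+z] (h (suc k)) (k * h (k ∸ 1)) ((m ∸ k) * h (suc k)) ⟩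
    k * h (k ∸ 1) + suc (m ∸ k) * h (suc k)
      ≡⟨ cong (λ x → k * h (k ∸ 1) + x * h (suc k)) (+-∸-assoc 1 (weight≤length u)) ⟨
    k * h (k ∸ 1) + (suc m ∸ k) * h (suc k)                      ∎
    where
    k : ℕ
    k = weight u
    x+[y+z]≡y+[x+z] : ∀ x y z → x + (y + z) ≡ y + (x + z)
    x+[y+z]≡y+[x+z] = solve-∀

  ⟦_≡ᵇ_⟧ : ℕ → ℕ → ℕ
  ⟦ k ≡ᵇ i ⟧ = if k ≡ᵇ i then 1 else 0

  *-⟦≡ᵇ⟧ : ∀ (f : ℕ → ℕ) k i → f k * ⟦ k ≡ᵇ i ⟧ ≡ f i * ⟦ k ≡ᵇ i ⟧
  *-⟦≡ᵇ⟧ f k i with k ≡ᵇ i in eq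
  ... | true  = cong (λ j → f j * 1) (≡ᵇ⇒≡ k i (subst T (sym eq) tt))
  ... | false = trans (*-zeroʳ (f k)) (sym (*-zeroʳ (f i)))

  ∑-⟦weight≡ᵇ⟧ : ∀ m i → (∑[ w ← allWords m ] ⟦ weight w ≡ᵇ i ⟧) ≡ m C i
  ∑-⟦weight≡ᵇ⟧ zero    zero    = refl
  ∑-⟦weight≡ᵇ⟧ zero    (suc i) = refl
  ∑-⟦weight≡ᵇ⟧ (suc m) zero    = begin
    (∑[ w ← allWords (suc m) ] ⟦ weight w ≡ᵇ 0 ⟧)                              ≡⟨ ∑-allWords-suc m _ ⟩
    (∑[ w ← allWords m ] ⟦ weight w ≡ᵇ 0 ⟧) + (∑[ _ ← allWords m ] 0)
      ≡⟨ cong₂ _+_ (∑-⟦weight≡ᵇ⟧ m 0) (∑-zero (allWords m)) ⟩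
    suc m C 0                                                                 ∎
  ∑-⟦weight≡ᵇ⟧ (suc m) (suc i) = begin
    (∑[ w ← allWords (suc m) ] ⟦ weight w ≡ᵇ suc i ⟧)                          ≡⟨ ∑-allWords-suc m _ ⟩
    (∑[ w ← allWords m ] ⟦ weight w ≡ᵇ suc i ⟧) + (∑[ w ← allWords m ] ⟦ weight w ≡ᵇ i ⟧)
      ≡⟨ cong₂ _+_ (∑-⟦weight≡ᵇ⟧ m (suc i)) (∑-⟦weight≡ᵇ⟧ m i) ⟩
    m C suc i + m C i
      ≡⟨ +-comm (m C suc i) (m C i) ⟩
    m C i + m C suc i
      ≡⟨ nCk+nC[k+1]≡[n+1]C[k+1] m i ⟩
    suc m C suc i                                                             ∎

  A-zero : ∀ {m} (𝒞 : Code m) → A 𝒞 0 ≡ b2n (𝒞 (zeroWord m))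
  A-zero {zero}  𝒞 = trans (+-identityʳ _) (*-identityʳ _)
  A-zero {suc m} 𝒞 = begin
    A 𝒞 0                                                                     ≡⟨ ∑-allWords-suc m _ ⟩
    A (𝒞 ∘ (false ∷_)) 0 + (∑[ w ← allWords m ] b2n (𝒞 (true ∷ w)) * 0)
      ≡⟨ cong₂ _+_ (A-zero (𝒞 ∘ (false ∷_))) (∑-cong (λ w → *-zeroʳ (b2n (𝒞 (true ∷ w)))) (allWords m)) ⟩
    b2n (𝒞 (zeroWord (suc m))) + (∑[ _ ← allWords m ] 0)
      ≡⟨ cong (b2n (𝒞 (zeroWord (suc m))) +_) (∑-zero (allWords m)) ⟩
    b2n (𝒞 (zeroWord (suc m))) + 0                                            ≡⟨ +-identityʳ _ ⟩
    b2n (𝒞 (zeroWord (suc m)))                                                ∎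

  k*⟦k∸1≡ᵇi⟧ : ∀ k i → k * ⟦ k ∸ 1 ≡ᵇ i ⟧ ≡ suc i * ⟦ k ≡ᵇ suc i ⟧
  k*⟦k∸1≡ᵇi⟧ zero    i = sym (*-zeroʳ (suc i))
  k*⟦k∸1≡ᵇi⟧ (suc k) i = *-⟦≡ᵇ⟧ suc k i

  module _ {m} {𝒞 : Code m} (diamond : IsDiamond 𝒞) where

    private
      χ : Word m → ℕ
      χ w = b2n (𝒞 w)

    codeNeighbours-diamond : ∀ w → codeNeighbours 𝒞 w ≡ suc (χ w)
    codeNeighbours-diamond w with 𝒞 w in eq
    ... | true  = IsDiamond.codewordNbrs diamond w eq
    ... | false = IsDiamond.noncodeNbrs diamond w eq

    diamond-count : ∀ i → m C i + A 𝒞 i ≡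
      (∑[ w ← allWords m ] χ w * (weight w * ⟦ weight w ∸ 1 ≡ᵇ i ⟧ + (m ∸ weight w) * ⟦ suc (weight w) ≡ᵇ i ⟧))
    diamond-count i = begin
      m C i + A 𝒞 i                                         ≡⟨ cong (_+ A 𝒞 i) (∑-⟦weight≡ᵇ⟧ m i) ⟨
      (∑[ w ← allWords m ] ⟦ weight w ≡ᵇ i ⟧) + A 𝒞 i       ≡⟨ ∑-+ _ _ (allWords m) ⟨
      (∑[ w ← allWords m ] ⟦ weight w ≡ᵇ i ⟧ + χ w * ⟦ weight w ≡ᵇ i ⟧)
        ≡⟨ ∑-cong (λ w → a*[1+x]≡a+x*a ⟦ weight w ≡ᵇ i ⟧ (χ w)) (allWords m) ⟨
      (∑[ w ← allWords m ] ⟦ weight w ≡ᵇ i ⟧ * suc (χ w))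
        ≡⟨ ∑-cong (λ w → cong (⟦ weight w ≡ᵇ i ⟧ *_) (codeNeighbours-diamond w)) (allWords m) ⟨
      (∑[ w ← allWords m ] ⟦ weight w ≡ᵇ i ⟧ * neighbourSum χ w)
        ≡⟨ ∑-neighbourSum m χ (λ w → ⟦ weight w ≡ᵇ i ⟧) ⟩
      (∑[ w ← allWords m ] χ w * neighbourSum (λ w → ⟦ weight w ≡ᵇ i ⟧) w)
        ≡⟨ ∑-cong (λ w → cong (χ w *_) (neighbourSum-weight m ⟦_≡ᵇ i ⟧ w)) (allWords m) ⟩
      (∑[ w ← allWords m ] χ w * (weight w * ⟦ weight w ∸ 1 ≡ᵇ i ⟧ + (m ∸ weight w) * ⟦ suc (weight w) ≡ᵇ i ⟧)) ∎
      where
      a*[1+x]≡a+x*a : ∀ a x → a * suc x ≡ a + x * a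
      a*[1+x]≡a+x*a = solve-∀

    A₁≡1+A₀ : A 𝒞 1 ≡ suc (A 𝒞 0)
    A₁≡1+A₀ = sym (begin
      m C 0 + A 𝒞 0                                                             ≡⟨ diamond-count 0 ⟩
      (∑[ w ← allWords m ] χ w * (weight w * ⟦ weight w ∸ 1 ≡ᵇ 0 ⟧ + (m ∸ weight w) * 0))
        ≡⟨ ∑-cong (λ w → cong (χ w *_) (only-down (weight w))) (allWords m) ⟩
      A 𝒞 1                                                                     ∎)
      where
      only-down : ∀ k → k * ⟦ k ∸ 1 ≡ᵇ 0 ⟧ + (m ∸ k) * 0 ≡ ⟦ k ≡ᵇ 1 ⟧
      only-down k = begin
        k * ⟦ k ∸ 1 ≡ᵇ 0 ⟧ + (m ∸ k) * 0 ≡⟨ cong₂ _+_ (k*⟦k∸1≡ᵇi⟧ k 0) (*-zeroʳ (m ∸ k)) ⟩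
        1 * ⟦ k ≡ᵇ 1 ⟧ + 0               ≡⟨ +-identityʳ _ ⟩
        1 * ⟦ k ≡ᵇ 1 ⟧                   ≡⟨ *-identityˡ _ ⟩
        ⟦ k ≡ᵇ 1 ⟧                       ∎

    diamond-recurrence : ∀ i →
      suc (suc i) * A 𝒞 (suc (suc i)) + (m ∸ i) * A 𝒞 i ≡ A 𝒞 (suc i) + m C suc i
    diamond-recurrence i = sym (begin
      A 𝒞 (suc i) + m C suc i                                     ≡⟨ +-comm (A 𝒞 (suc i)) (m C suc i) ⟩
      m C suc i + A 𝒞 (suc i)                                     ≡⟨ diamond-count (suc i) ⟩
      (∑[ w ← allWords m ] χ w * (weight w * ⟦ weight w ∸ 1 ≡ᵇ suc i ⟧ + (m ∸ weight w) * ⟦ weight w ≡ᵇ i ⟧))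
        ≡⟨ ∑-cong (λ w → cong (χ w *_) (cong₂ _+_ (k*⟦k∸1≡ᵇi⟧ (weight w) (suc i))
                                                  (*-⟦≡ᵇ⟧ (m ∸_) (weight w) i))) (allWords m) ⟩
      (∑[ w ← allWords m ] χ w * (suc (suc i) * ⟦ weight w ≡ᵇ suc (suc i) ⟧ + (m ∸ i) * ⟦ weight w ≡ᵇ i ⟧))
        ≡⟨ ∑-cong (λ w → distrib (χ w) (suc (suc i)) _ (m ∸ i) _) (allWords m) ⟩
      (∑[ w ← allWords m ] suc (suc i) * (χ w * ⟦ weight w ≡ᵇ suc (suc i) ⟧) + (m ∸ i) * (χ w * ⟦ weight w ≡ᵇ i ⟧))
        ≡⟨ ∑-+ _ _ (allWords m) ⟩
      (∑[ w ← allWords m ] suc (suc i) * (χ w * ⟦ weight w ≡ᵇ suc (suc i) ⟧))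
        + (∑[ w ← allWords m ] (m ∸ i) * (χ w * ⟦ weight w ≡ᵇ i ⟧))
        ≡⟨ cong₂ _+_ (∑-*ˡ (suc (suc i)) _ (allWords m)) (∑-*ˡ (m ∸ i) _ (allWords m)) ⟩
      suc (suc i) * A 𝒞 (suc (suc i)) + (m ∸ i) * A 𝒞 i           ∎)
      where
      distrib : ∀ x a y b z → x * (a * y + b * z) ≡ a * (x * y) + b * (x * z)
      distrib = solve-∀

module Arithmetic where

  open import Data.Nat using (ℕ; zero; suc; _+_; _*_; _∸_; z≤n; s≤s; _≤?_; ⌊_/2⌋; ⌈_/2⌉; _%_; _/_)
  open import Data.Nat.Properties
  open import Data.Nat.DivMod using (m/n≡1+[m∸n]/n)
  open import Data.Nat.Combinatorics using (_C_; nCk+nC[k+1]≡[n+1]C[k+1]; nC1≡n; k>n⇒nCk≡0)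
  open import Data.Nat.Tactic.RingSolver using (solve-∀)
  open import Relation.Nullary using (yes; no)
  open import Relation.Binary.PropositionalEquality
  open ≡-Reasoning

  [1+k]*[1+n]C[1+k]≡[1+n]*nCk : ∀ n k → suc k * (suc n C suc k) ≡ suc n * (n C k)
  [1+k]*[1+n]C[1+k]≡[1+n]*nCk n zero = trans (+-identityʳ _) (trans (nC1≡n (suc n)) (sym (*-identityʳ (suc n))))
  [1+k]*[1+n]C[1+k]≡[1+n]*nCk zero (suc k) = *-zeroʳ (suc (suc k))
  [1+k]*[1+n]C[1+k]≡[1+n]*nCk (suc n) (suc k) = begin
    suc (suc k) * (suc (suc n) C suc (suc k))
      ≡⟨ cong (suc (suc k) *_) (nCk+nC[k+1]≡[n+1]C[k+1] (suc n) (suc k)) ⟨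
    suc (suc k) * (c + c′)                       ≡⟨ regroup (suc k) c c′ ⟩
    c + (suc k * c + suc (suc k) * c′)
      ≡⟨ cong (c +_) (cong₂ _+_ ([1+k]*[1+n]C[1+k]≡[1+n]*nCk n k) ([1+k]*[1+n]C[1+k]≡[1+n]*nCk n (suc k))) ⟩
    c + (suc n * (n C k) + suc n * (n C suc k))
      ≡⟨ cong (c +_) (*-distribˡ-+ (suc n) (n C k) (n C suc k)) ⟨
    c + suc n * (n C k + n C suc k)
      ≡⟨ cong (λ x → c + suc n * x) (nCk+nC[k+1]≡[n+1]C[k+1] n k) ⟩
    suc (suc n) * c                              ∎
    where
    c c′ : ℕ
    c  = suc n C suc k
    c′ = suc n C suc (suc k)
    regroup : ∀ k c c′ → suc k * (c + c′) ≡ c + (k * c + suc k * c′)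
    regroup = solve-∀

  [1+n∸k]*[1+n]Ck≡[1+n]*nCk : ∀ n k → (suc n ∸ k) * (suc n C k) ≡ suc n * (n C k)
  [1+n∸k]*[1+n]Ck≡[1+n]*nCk n zero    = refl
  [1+n∸k]*[1+n]Ck≡[1+n]*nCk n (suc k) = begin
    (n ∸ k) * c                                    ≡⟨ *-distribʳ-∸ c (suc n) (suc k) ⟩
    suc n * c ∸ suc k * c                          ≡⟨ cong (_∸ suc k * c) pascal-scaled ⟩
    suc k * c + suc n * (n C suc k) ∸ suc k * c    ≡⟨ m+n∸m≡n (suc k * c) _ ⟩
    suc n * (n C suc k)                            ∎
    where
    c : ℕ
    c = suc n C suc k
    pascal-scaled : suc n * c ≡ suc k * c + suc n * (n C suc k)
    pascal-scaled = begin
      suc n * c                                   ≡⟨ cong (suc n *_) (nCk+nC[k+1]≡[n+1]C[k+1] n k) ⟨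
      suc n * (n C k + n C suc k)                 ≡⟨ *-distribˡ-+ (suc n) (n C k) (n C suc k) ⟩
      suc n * (n C k) + suc n * (n C suc k)
        ≡⟨ cong (_+ suc n * (n C suc k)) ([1+k]*[1+n]C[1+k]≡[1+n]*nCk n k) ⟨
      suc k * c + suc n * (n C suc k)             ∎

  [1+k]*nC[1+k]≡[n∸k]*nCk : ∀ n k → suc k * (n C suc k) ≡ (n ∸ k) * (n C k)
  [1+k]*nC[1+k]≡[n∸k]*nCk zero    k = trans (*-zeroʳ (suc k)) (cong (_* (0 C k)) (sym (0∸n≡0 k)))
  [1+k]*nC[1+k]≡[n∸k]*nCk (suc n) k = trans ([1+k]*[1+n]C[1+k]≡[1+n]*nCk n k) (sym ([1+n∸k]*[1+n]Ck≡[1+n]*nCk n k))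

  binomial-recurrence : ∀ m i → suc (suc i) * (m C suc (suc i)) + (m ∸ i) * (m C i) ≡ m * (m C suc i)
  binomial-recurrence zero    i = cong₂ _+_ (*-zeroʳ (suc (suc i))) (cong (_* (0 C i)) (0∸n≡0 i))
  binomial-recurrence (suc n) i = begin
    suc (suc i) * (suc n C suc (suc i)) + (suc n ∸ i) * (suc n C i)
      ≡⟨ cong₂ _+_ ([1+k]*[1+n]C[1+k]≡[1+n]*nCk n (suc i)) ([1+n∸k]*[1+n]Ck≡[1+n]*nCk n i) ⟩
    suc n * (n C suc i) + suc n * (n C i)   ≡⟨ *-distribˡ-+ (suc n) (n C suc i) (n C i) ⟨
    suc n * (n C suc i + n C i)
      ≡⟨ cong (suc n *_) (trans (+-comm (n C suc i) (n C i)) (nCk+nC[k+1]≡[n+1]C[k+1] n i)) ⟩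
    suc n * (suc n C suc i)                 ∎

  [m+m]∸[n+n]≡[m∸n]+[m∸n] : ∀ m n → (m + m) ∸ (n + n) ≡ (m ∸ n) + (m ∸ n)
  [m+m]∸[n+n]≡[m∸n]+[m∸n] zero    n       = trans (0∸n≡0 (n + n)) (sym (cong (λ x → x + x) (0∸n≡0 n)))
  [m+m]∸[n+n]≡[m∸n]+[m∸n] (suc m) zero    = refl
  [m+m]∸[n+n]≡[m∸n]+[m∸n] (suc m) (suc n) rewrite +-suc m m | +-suc n n = [m+m]∸[n+n]≡[m∸n]+[m∸n] m n

  [2+2k]*NC[1+k]≡[2N∸2k]*NCk : ∀ N k → (2 + (k + k)) * (N C suc k) ≡ (N + N ∸ (k + k)) * (N C k)
  [2+2k]*NC[1+k]≡[2N∸2k]*NCk N k = begin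
    (2 + (k + k)) * (N C suc k)                 ≡⟨ double k (N C suc k) ⟩
    suc k * (N C suc k) + suc k * (N C suc k)   ≡⟨ cong (λ x → x + x) ([1+k]*nC[1+k]≡[n∸k]*nCk N k) ⟩
    (N ∸ k) * (N C k) + (N ∸ k) * (N C k)       ≡⟨ *-distribʳ-+ (N C k) (N ∸ k) (N ∸ k) ⟨
    ((N ∸ k) + (N ∸ k)) * (N C k)               ≡⟨ cong (_* (N C k)) ([m+m]∸[n+n]≡[m∸n]+[m∸n] N k) ⟨
    (N + N ∸ (k + k)) * (N C k)                 ∎
    where
    double : ∀ k c → (2 + (k + k)) * c ≡ suc k * c + suc k * c
    double = solve-∀

  [1+2N∸2k]*NCk≡NCk+[2N∸2k]*NCk : ∀ N k → (suc (N + N) ∸ (k + k)) * (N C k) ≡ N C k + (N + N ∸ (k + k)) * (N C k)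
  [1+2N∸2k]*NCk≡NCk+[2N∸2k]*NCk N k with k ≤? N
  ... | yes k≤N = cong (_* (N C k)) (+-∸-assoc 1 (+-mono-≤ k≤N k≤N))
  ... | no  k≰N rewrite k>n⇒nCk≡0 (≰⇒> k≰N) = trans (*-zeroʳ (suc (N + N) ∸ (k + k))) (sym (*-zeroʳ (N + N ∸ (k + k))))

  [2+2k]*NC[1+k]+NCk≡[1+2N∸2k]*NCk : ∀ N k → (2 + (k + k)) * (N C suc k) + N C k ≡ (suc (N + N) ∸ (k + k)) * (N C k)
  [2+2k]*NC[1+k]+NCk≡[1+2N∸2k]*NCk N k = begin
    (2 + (k + k)) * (N C suc k) + N C k        ≡⟨ +-comm _ (N C k) ⟩
    N C k + (2 + (k + k)) * (N C suc k)        ≡⟨ cong (N C k +_) ([2+2k]*NC[1+k]≡[2N∸2k]*NCk N k) ⟩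
    N C k + (N + N ∸ (k + k)) * (N C k)        ≡⟨ [1+2N∸2k]*NCk≡NCk+[2N∸2k]*NCk N k ⟨
    (suc (N + N) ∸ (k + k)) * (N C k)          ∎

  [3+2k]*NC[1+k]≡[2N∸2k]*NCk+NC[1+k] : ∀ N k → (3 + (k + k)) * (N C suc k) ≡ (N + N ∸ (k + k)) * (N C k) + N C suc k
  [3+2k]*NC[1+k]≡[2N∸2k]*NCk+NC[1+k] N k =
    trans (cong (N C suc k +_) ([2+2k]*NC[1+k]≡[2N∸2k]*NCk N k)) (+-comm (N C suc k) _)

  data ParityView : ℕ → Set where
    even : ∀ k → ParityView (k + k)
    odd  : ∀ k → ParityView (suc (k + k))

  parityView : ∀ i → ParityView i
  parityView zero = even zero
  parityView (suc i) with parityView i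
  ... | even k = odd k
  ... | odd  k = subst ParityView (cong suc (+-suc k k)) (even (suc k))

  [k+k]%2≡0 : ∀ k → (k + k) % 2 ≡ 0
  [k+k]%2≡0 zero    = refl
  [k+k]%2≡0 (suc k) rewrite +-suc k k = [k+k]%2≡0 k

  even⇒⌊n/2⌋≡⌈n/2⌉ : ∀ n → n % 2 ≡ 0 → ⌊ n /2⌋ ≡ ⌈ n /2⌉
  even⇒⌊n/2⌋≡⌈n/2⌉ zero          _      = refl
  even⇒⌊n/2⌋≡⌈n/2⌉ (suc (suc n)) n-even = cong suc (even⇒⌊n/2⌋≡⌈n/2⌉ n n-even)

  [1+n]%2≡1⇒n%2≡0 : ∀ n → suc n % 2 ≡ 1 → n % 2 ≡ 0
  [1+n]%2≡1⇒n%2≡0 zero          _          = refl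
  [1+n]%2≡1⇒n%2≡0 (suc (suc n)) [3+n]%2≡1 = [1+n]%2≡1⇒n%2≡0 n [3+n]%2≡1

  n/2≡⌊n/2⌋ : ∀ n → n / 2 ≡ ⌊ n /2⌋
  n/2≡⌊n/2⌋ 0             = refl
  n/2≡⌊n/2⌋ 1             = refl
  n/2≡⌊n/2⌋ (suc (suc n)) = trans (m/n≡1+[m∸n]/n {suc (suc n)} {2} (s≤s (s≤s z≤n))) (cong suc (n/2≡⌊n/2⌋ n))

module WeightEnumerator where

  open import Data.Nat as ℕ using (ℕ; zero; suc; _∸_; _≤_; s≤s; ⌊_/2⌋; ⌈_/2⌉; _%_; _/_)
  import Data.Nat.Properties as ℕ
  open import Data.Nat.Combinatorics using (_C_; nCk+nC[k+1]≡[n+1]C[k+1]; nCk≡nC[n∸k]; nCn≡1; nC1≡n)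
  open import Data.Integer using (ℤ; +_; _+_; _*_; _-_; _^_; 0ℤ; 1ℤ; -1ℤ)
  open import Data.Integer.Properties
  open import Algebra.Properties.AbelianGroup +-0-abelianGroup using (∙-cancelʳ)
  open import Data.Integer.Tactic.RingSolver using (solve-∀)
  open import Data.Product using (_×_; _,_; proj₁)
  open import Relation.Binary.PropositionalEquality
  open ≡-Reasoning

  open Arithmetic
  open HammingCube using (A₁≡1+A₀; diamond-recurrence)

  -- A record rather than a Π-type, so that b and x are inferred from a proof.
  record Recurrence (m : ℕ) (b x : ℕ → ℤ) : Set where
    field
      step : ∀ i → + suc (suc i) * x (suc (suc i)) + + (m ∸ i) * x i ≡ x (suc i) + b i

  open Recurrence

  recurrence-unique : ∀ {m b x y} → Recurrence m b x → Recurrence m b y →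
                      x 0 ≡ y 0 → x 1 ≡ y 1 → ∀ i → x i ≡ y i
  recurrence-unique {m} {b} {x} {y} rec-x rec-y x₀≡y₀ x₁≡y₁ i = proj₁ (agree i)
    where
    next : ∀ i → x i ≡ y i → x (suc i) ≡ y (suc i) → x (suc (suc i)) ≡ y (suc (suc i))
    next i xᵢ≡yᵢ xᵢ₊₁≡yᵢ₊₁ = *-cancelˡ-≡ p _ _ (∙-cancelʳ (t * x i) _ _ (begin
      p * x (suc (suc i)) + t * x i   ≡⟨ step rec-x i ⟩
      x (suc i) + b i                 ≡⟨ cong (_+ b i) xᵢ₊₁≡yᵢ₊₁ ⟩
      y (suc i) + b i                 ≡⟨ step rec-y i ⟨
      p * y (suc (suc i)) + t * y i   ≡⟨ cong (λ z → p * y (suc (suc i)) + t * z) xᵢ≡yᵢ ⟨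
      p * y (suc (suc i)) + t * x i   ∎))
      where
      p t : ℤ
      p = + suc (suc i)
      t = + (m ∸ i)
    agree : ∀ i → x i ≡ y i × x (suc i) ≡ y (suc i)
    agree zero    = x₀≡y₀ , x₁≡y₁
    agree (suc i) with agree i
    ... | xᵢ≡yᵢ , xᵢ₊₁≡yᵢ₊₁ = xᵢ₊₁≡yᵢ₊₁ , next i xᵢ≡yᵢ xᵢ₊₁≡yᵢ₊₁

  recurrence-scale : ∀ {m b x} c → Recurrence m b x → Recurrence m (λ i → c * b i) (λ i → c * x i)
  recurrence-scale {m} {b} {x} c rec .step i = begin
    p * (c * x (suc (suc i))) + t * (c * x i)  ≡⟨ factor c p (x (suc (suc i))) t (x i) ⟩
    c * (p * x (suc (suc i)) + t * x i)        ≡⟨ cong (c *_) (step rec i) ⟩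
    c * (x (suc i) + b i)                      ≡⟨ *-distribˡ-+ c (x (suc i)) (b i) ⟩
    c * x (suc i) + c * b i                    ∎
    where
    p t : ℤ
    p = + suc (suc i)
    t = + (m ∸ i)
    factor : ∀ c p y t z → p * (c * y) + t * (c * z) ≡ c * (p * y + t * z)
    factor = solve-∀

  recurrence-+-homogeneous : ∀ {m b x e} → Recurrence m b x → Recurrence m (λ _ → 0ℤ) e →
                             ∀ l → Recurrence m b (λ i → x i + l * e i)
  recurrence-+-homogeneous {m} {b} {x} {e} rec-x rec-e l .step i = begin
    p * (x₂ + l * e₂) + t * (x₀ + l * e₀)      ≡⟨ regroup p t l x₂ x₀ e₂ e₀ ⟩
    (p * x₂ + t * x₀) + l * (p * e₂ + t * e₀)
      ≡⟨ cong₂ (λ u v → u + l * v) (step rec-x i) (step rec-e i) ⟩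
    (x (suc i) + b i) + l * (e (suc i) + 0ℤ)   ≡⟨ regroup′ (x (suc i)) (b i) l (e (suc i)) ⟩
    (x (suc i) + l * e (suc i)) + b i          ∎
    where
    p t : ℤ
    p = + suc (suc i)
    t = + (m ∸ i)
    x₂ x₀ e₂ e₀ : ℤ
    x₂ = x (suc (suc i)); x₀ = x i; e₂ = e (suc (suc i)); e₀ = e i
    regroup : ∀ p t l x₂ x₀ e₂ e₀ → p * (x₂ + l * e₂) + t * (x₀ + l * e₀) ≡ (p * x₂ + t * x₀) + l * (p * e₂ + t * e₀)
    regroup = solve-∀
    regroup′ : ∀ x b l e → (x + b) + l * (e + 0ℤ) ≡ (x + l * e) + b
    regroup′ = solve-∀

  pos-linear : ∀ a x b y → + (a ℕ.* x ℕ.+ b ℕ.* y) ≡ + a * + x + + b * + y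
  pos-linear a x b y = trans (pos-+ (a ℕ.* x) (b ℕ.* y)) (cong₂ _+_ (pos-* a x) (pos-* b y))

  recurrence-binomial : ∀ n → Recurrence (suc n) (λ i → + n * + (suc n C suc i)) (λ i → + (suc n C i))
  recurrence-binomial n .step i = begin
    + suc (suc i) * + (suc n C suc (suc i)) + + (suc n ∸ i) * + (suc n C i)
      ≡⟨ pos-linear (suc (suc i)) (suc n C suc (suc i)) (suc n ∸ i) (suc n C i) ⟨
    + (suc (suc i) ℕ.* (suc n C suc (suc i)) ℕ.+ (suc n ∸ i) ℕ.* (suc n C i))
      ≡⟨ cong +_ (binomial-recurrence (suc n) i) ⟩
    + (suc n C suc i ℕ.+ n ℕ.* (suc n C suc i))
      ≡⟨ pos-+ (suc n C suc i) (n ℕ.* (suc n C suc i)) ⟩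
    + (suc n C suc i) + + (n ℕ.* (suc n C suc i))
      ≡⟨ cong (_+_ (+ (suc n C suc i))) (pos-* n (suc n C suc i)) ⟩
    + (suc n C suc i) + + n * + (suc n C suc i) ∎

  recurrence-diamond : ∀ {m} {𝒞 : Code m} → IsDiamond 𝒞 → Recurrence m (λ i → + (m C suc i)) (λ i → + A 𝒞 i)
  recurrence-diamond {m} {𝒞} diamond .step i = begin
    + suc (suc i) * + A 𝒞 (suc (suc i)) + + (m ∸ i) * + A 𝒞 i
      ≡⟨ pos-linear (suc (suc i)) (A 𝒞 (suc (suc i))) (m ∸ i) (A 𝒞 i) ⟨
    + (suc (suc i) ℕ.* A 𝒞 (suc (suc i)) ℕ.+ (m ∸ i) ℕ.* A 𝒞 i) ≡⟨ cong +_ (diamond-recurrence diamond i) ⟩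
    + (A 𝒞 (suc i) ℕ.+ m C suc i)                              ≡⟨ pos-+ (A 𝒞 (suc i)) (m C suc i) ⟩
    + A 𝒞 (suc i) + + (m C suc i)                              ∎

  [-1]^k*[-1]^k≡1 : ∀ k → (-1ℤ) ^ k * (-1ℤ) ^ k ≡ 1ℤ
  [-1]^k*[-1]^k≡1 zero    = refl
  [-1]^k*[-1]^k≡1 (suc k) = trans (square-neg ((-1ℤ) ^ k)) ([-1]^k*[-1]^k≡1 k)
    where
    square-neg : ∀ s → (-1ℤ * s) * (-1ℤ * s) ≡ s * s
    square-neg = solve-∀

  [-1]^[n∸k]≡[-1]^k : ∀ {n k} → (-1ℤ) ^ n ≡ 1ℤ → k ≤ n → (-1ℤ) ^ (n ∸ k) ≡ (-1ℤ) ^ k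
  [-1]^[n∸k]≡[-1]^k {n} {k} [-1]^n≡1 k≤n = begin
    s (n ∸ k)                       ≡⟨ *-identityʳ (s (n ∸ k)) ⟨
    s (n ∸ k) * 1ℤ                  ≡⟨ cong (s (n ∸ k) *_) ([-1]^k*[-1]^k≡1 k) ⟨
    s (n ∸ k) * (s k * s k)          ≡⟨ *-assoc (s (n ∸ k)) (s k) (s k) ⟨
    s (n ∸ k) * s k * s k            ≡⟨ cong (_* s k) (^-distribˡ-+-* -1ℤ (n ∸ k) k) ⟨
    s (n ∸ k ℕ.+ k) * s k            ≡⟨ cong (λ j → s j * s k) (ℕ.m∸n+n≡m k≤n) ⟩
    s n * s k                        ≡⟨ cong (_* s k) [-1]^n≡1 ⟩
    1ℤ * s k                         ≡⟨ *-identityˡ (s k) ⟩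
    s k                              ∎
    where
    s : ℕ → ℤ
    s j = (-1ℤ) ^ j

  altBinomial : ℕ → ℕ → ℤ
  altBinomial N i = (-1ℤ) ^ ⌊ i /2⌋ * + (N C ⌊ i /2⌋)

  altBinomial-at : ∀ N {i k} → k ≡ ⌊ i /2⌋ → altBinomial N i ≡ (-1ℤ) ^ k * + (N C k)
  altBinomial-at N k≡⌊i/2⌋ = cong (λ k → (-1ℤ) ^ k * + (N C k)) (sym k≡⌊i/2⌋)

  pos-*-+ : ∀ a x y → + (a ℕ.* x ℕ.+ y) ≡ + a * + x + + y
  pos-*-+ a x y = trans (pos-+ (a ℕ.* x) y) (cong (_+ + y) (pos-* a x))

  sign-split : ∀ p t s c c′ → p * ((-1ℤ * s) * c′) + t * (s * c) ≡ s * (t * c) - s * (p * c′)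
  sign-split = solve-∀

  altBinomial-recurrence-even : ∀ N k →
    + suc (suc (k ℕ.+ k)) * altBinomial N (suc (suc (k ℕ.+ k)))
      + + (suc (N ℕ.+ N) ∸ (k ℕ.+ k)) * altBinomial N (k ℕ.+ k)
      ≡ altBinomial N (suc (k ℕ.+ k)) + 0ℤ
  altBinomial-recurrence-even N k = begin
    p * altBinomial N (suc (suc (k ℕ.+ k))) + t * altBinomial N (k ℕ.+ k)
      ≡⟨ cong₂ (λ u v → p * u + t * v) (altBinomial-at N (cong suc (ℕ.n≡⌊n+n/2⌋ k))) (altBinomial-at N (ℕ.n≡⌊n+n/2⌋ k)) ⟩
    p * ((-1ℤ * s) * c′) + t * (s * c)    ≡⟨ sign-split p t s c c′ ⟩
    s * (t * c) - s * (p * c′)             ≡⟨ cong (λ u → s * u - s * (p * c′)) pc′+c≡tc ⟨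
    s * (p * c′ + c) - s * (p * c′)        ≡⟨ cancel s (p * c′) c ⟩
    s * c + 0ℤ                             ≡⟨ cong (_+ 0ℤ) (altBinomial-at N (ℕ.n≡⌈n+n/2⌉ k)) ⟨
    altBinomial N (suc (k ℕ.+ k)) + 0ℤ     ∎
    where
    p t s c c′ : ℤ
    p = + suc (suc (k ℕ.+ k))
    t = + (suc (N ℕ.+ N) ∸ (k ℕ.+ k))
    s = (-1ℤ) ^ k
    c = + (N C k)
    c′ = + (N C suc k)
    pc′+c≡tc : p * c′ + c ≡ t * c
    pc′+c≡tc = trans (sym (pos-*-+ (suc (suc (k ℕ.+ k))) (N C suc k) (N C k)))
      (trans (cong +_ ([2+2k]*NC[1+k]+NCk≡[1+2N∸2k]*NCk N k)) (pos-* (suc (N ℕ.+ N) ∸ (k ℕ.+ k)) (N C k)))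
    cancel : ∀ s u c → s * (u + c) - s * u ≡ s * c + 0ℤ
    cancel = solve-∀

  altBinomial-recurrence-odd : ∀ N k →
    + suc (suc (suc (k ℕ.+ k))) * altBinomial N (suc (suc (suc (k ℕ.+ k))))
      + + (N ℕ.+ N ∸ (k ℕ.+ k)) * altBinomial N (suc (k ℕ.+ k))
      ≡ altBinomial N (suc (suc (k ℕ.+ k))) + 0ℤ
  altBinomial-recurrence-odd N k = begin
    p * altBinomial N (suc (suc (suc (k ℕ.+ k)))) + t * altBinomial N (suc (k ℕ.+ k))
      ≡⟨ cong₂ (λ u v → p * u + t * v) (altBinomial-at N (cong suc (ℕ.n≡⌈n+n/2⌉ k))) (altBinomial-at N (ℕ.n≡⌈n+n/2⌉ k)) ⟩
    p * ((-1ℤ * s) * c′) + t * (s * c)    ≡⟨ sign-split p t s c c′ ⟩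
    s * (t * c) - s * (p * c′)             ≡⟨ cong (λ u → s * (t * c) - s * u) pc′≡tc+c′ ⟩
    s * (t * c) - s * (t * c + c′)         ≡⟨ cancel s (t * c) c′ ⟩
    (-1ℤ * s) * c′ + 0ℤ
      ≡⟨ cong (_+ 0ℤ) (altBinomial-at N (cong suc (ℕ.n≡⌊n+n/2⌋ k))) ⟨
    altBinomial N (suc (suc (k ℕ.+ k))) + 0ℤ ∎
    where
    p t s c c′ : ℤ
    p = + suc (suc (suc (k ℕ.+ k)))
    t = + (N ℕ.+ N ∸ (k ℕ.+ k))
    s = (-1ℤ) ^ k
    c = + (N C k)
    c′ = + (N C suc k)
    pc′≡tc+c′ : p * c′ ≡ t * c + c′
    pc′≡tc+c′ = trans (sym (pos-* (suc (suc (suc (k ℕ.+ k)))) (N C suc k)))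
      (trans (cong +_ ([3+2k]*NC[1+k]≡[2N∸2k]*NCk+NC[1+k] N k)) (pos-*-+ (N ℕ.+ N ∸ (k ℕ.+ k)) (N C k) (N C suc k)))
    cancel : ∀ s u c′ → s * u - s * (u + c′) ≡ (-1ℤ * s) * c′ + 0ℤ
    cancel = solve-∀

  recurrence-altBinomial : ∀ N → Recurrence (suc (N ℕ.+ N)) (λ _ → 0ℤ) (altBinomial N)
  recurrence-altBinomial N .step i with parityView i
  ... | even k = altBinomial-recurrence-even N k
  ... | odd  k = altBinomial-recurrence-odd N k

  altBinomial-reflect : ∀ N → (-1ℤ) ^ N ≡ 1ℤ → ∀ i → i % 2 ≡ 1 → i ≤ N ℕ.+ N →
                        altBinomial N (suc (N ℕ.+ N) ∸ i) ≡ altBinomial N i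
  altBinomial-reflect N [-1]^N≡1 i i-odd i≤2N with parityView i
  ... | even k with () ← trans (sym ([k+k]%2≡0 k)) i-odd
  ... | odd  k = begin
    altBinomial N (N ℕ.+ N ∸ (k ℕ.+ k))  ≡⟨ cong (altBinomial N) ([m+m]∸[n+n]≡[m∸n]+[m∸n] N k) ⟩
    altBinomial N ((N ∸ k) ℕ.+ (N ∸ k))  ≡⟨ altBinomial-at N (ℕ.n≡⌊n+n/2⌋ (N ∸ k)) ⟩
    (-1ℤ) ^ (N ∸ k) * + (N C (N ∸ k))
      ≡⟨ cong₂ (λ s c → s * + c) ([-1]^[n∸k]≡[-1]^k [-1]^N≡1 k≤N) (sym (nCk≡nC[n∸k] k≤N)) ⟩
    (-1ℤ) ^ k * + (N C k)                ≡⟨ altBinomial-at N (ℕ.n≡⌈n+n/2⌉ k) ⟨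
    altBinomial N (suc (k ℕ.+ k))        ∎
    where
    k≤N : k ≤ N
    k≤N = subst₂ _≤_ (sym (ℕ.n≡⌈n+n/2⌉ k)) (sym (ℕ.n≡⌊n+n/2⌋ N)) (ℕ.⌊n/2⌋-mono i≤2N)

  sign₄ : ℕ → ℤ
  sign₄ 0 = 1ℤ
  sign₄ 3 = 1ℤ
  sign₄ _ = -1ℤ

  Δ≡sign₄*νC[i/2] : ∀ ν i → Δ ν i ≡ sign₄ (i % 4) * + (ν C (i / 2))
  Δ≡sign₄*νC[i/2] ν i with i % 4
  ... | 0                         = sym (*-identityˡ _)
  ... | 1                         = sym (-1*i≡-i _)
  ... | 2                         = sym (-1*i≡-i _)
  ... | 3                         = sym (*-identityˡ _)
  ... | suc (suc (suc (suc _))) = sym (-1*i≡-i _)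

  sign₄[i%4]≡[-1]^⌈i/2⌉ : ∀ i → sign₄ (i % 4) ≡ (-1ℤ) ^ ⌈ i /2⌉
  sign₄[i%4]≡[-1]^⌈i/2⌉ 0 = refl
  sign₄[i%4]≡[-1]^⌈i/2⌉ 1 = refl
  sign₄[i%4]≡[-1]^⌈i/2⌉ 2 = refl
  sign₄[i%4]≡[-1]^⌈i/2⌉ 3 = refl
  sign₄[i%4]≡[-1]^⌈i/2⌉ (suc (suc (suc (suc i)))) =
    trans (sign₄[i%4]≡[-1]^⌈i/2⌉ i) (sym (double-neg ((-1ℤ) ^ ⌈ i /2⌉)))
    where
    double-neg : ∀ s → -1ℤ * (-1ℤ * s) ≡ s
    double-neg = solve-∀

  Δ-closed-form : ∀ ν i → Δ ν i ≡ (-1ℤ) ^ ⌈ i /2⌉ * + (ν C ⌊ i /2⌋)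
  Δ-closed-form ν i = trans (Δ≡sign₄*νC[i/2] ν i)
    (cong₂ (λ s j → s * + (ν C j)) (sign₄[i%4]≡[-1]^⌈i/2⌉ i) (n/2≡⌊n/2⌋ i))

  altBinomial≡Δ+Δ : ∀ ν x → x % 2 ≡ 0 → altBinomial (suc ν) (suc (suc x)) ≡ Δ ν (suc x) + Δ ν (suc (suc x))
  altBinomial≡Δ+Δ ν x x-even = begin
    s * + (suc ν C suc q)
      ≡⟨ cong (λ c → s * + c) (nCk+nC[k+1]≡[n+1]C[k+1] ν q) ⟨
    s * + (ν C q ℕ.+ ν C suc q)                    ≡⟨ cong (s *_) (pos-+ (ν C q) (ν C suc q)) ⟩
    s * (+ (ν C q) + + (ν C suc q))                ≡⟨ *-distribˡ-+ s (+ (ν C q)) (+ (ν C suc q)) ⟩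
    s * + (ν C q) + s * + (ν C suc q)
      ≡⟨ cong₂ (λ j j′ → s * + (ν C j) + (-1ℤ) ^ suc j′ * + (ν C suc q)) ⌊x/2⌋≡⌈x/2⌉ ⌊x/2⌋≡⌈x/2⌉ ⟩
    (-1ℤ) ^ suc q * + (ν C ⌈ x /2⌉) + (-1ℤ) ^ suc ⌈ x /2⌉ * + (ν C suc q)
      ≡⟨ cong₂ _+_ (Δ-closed-form ν (suc x)) (Δ-closed-form ν (suc (suc x))) ⟨
    Δ ν (suc x) + Δ ν (suc (suc x))                ∎
    where
    q : ℕ
    q = ⌊ x /2⌋
    s : ℤ
    s = (-1ℤ) ^ suc q
    ⌊x/2⌋≡⌈x/2⌉ : q ≡ ⌈ x /2⌉
    ⌊x/2⌋≡⌈x/2⌉ = even⇒⌊n/2⌋≡⌈n/2⌉ x x-even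

  altBinomial-odd≡even : ∀ N x → x % 2 ≡ 0 → altBinomial N (suc (suc (suc x))) ≡ altBinomial N (suc (suc x))
  altBinomial-odd≡even N x x-even = altBinomial-at N (cong suc (even⇒⌊n/2⌋≡⌈n/2⌉ x x-even))

  altBinomial[2N]≡1 : ∀ N → (-1ℤ) ^ N ≡ 1ℤ → altBinomial N (N ℕ.+ N) ≡ 1ℤ
  altBinomial[2N]≡1 N [-1]^N≡1 = trans (altBinomial-at N (ℕ.n≡⌊n+n/2⌋ N)) (cong₂ (λ s c → s * + c) [-1]^N≡1 (nCn≡1 N))

  altBinomial[2N+1]≡1 : ∀ N → (-1ℤ) ^ N ≡ 1ℤ → altBinomial N (suc (N ℕ.+ N)) ≡ 1ℤ
  altBinomial[2N+1]≡1 N [-1]^N≡1 = trans (altBinomial-at N (ℕ.n≡⌈n+n/2⌉ N)) (cong₂ (λ s c → s * + c) [-1]^N≡1 (nCn≡1 N))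

  weight-formula : ∀ N {𝒞 : Code (suc (N ℕ.+ N))} → IsDiamond 𝒞 →
    ∀ l → + (N ℕ.+ N) * + A 𝒞 0 ≡ 1ℤ + l →
    ∀ i → + (N ℕ.+ N) * + A 𝒞 i ≡ + (suc (N ℕ.+ N) C i) + l * altBinomial N i
  weight-formula N {𝒞} diamond l nA₀≡1+l =
    recurrence-unique
    (recurrence-scale (+ n) (recurrence-diamond diamond))
    (recurrence-+-homogeneous (recurrence-binomial n) (recurrence-altBinomial N) l)
    (trans nA₀≡1+l (cong (_+_ 1ℤ) (sym (*-identityʳ l))))
    nA₁≡n+1+l
    where
    n : ℕ
    n = N ℕ.+ N
    nA₁≡n+1+l : + n * + A 𝒞 1 ≡ + (suc n C 1) + l * 1ℤ
    nA₁≡n+1+l = begin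
      + n * + A 𝒞 1              ≡⟨ cong (λ a → + n * + a) (A₁≡1+A₀ diamond) ⟩
      + n * (1ℤ + + A 𝒞 0)       ≡⟨ *-distribˡ-+ (+ n) 1ℤ (+ A 𝒞 0) ⟩
      + n * 1ℤ + + n * + A 𝒞 0   ≡⟨ cong₂ _+_ (*-identityʳ (+ n)) nA₀≡1+l ⟩
      + n + (1ℤ + l)             ≡⟨ regroup (+ n) l ⟩
      (1ℤ + + n) + l * 1ℤ        ≡⟨ cong (λ c → + c + l * 1ℤ) (nC1≡n (suc n)) ⟨
      + (suc n C 1) + l * 1ℤ     ∎
      where
      regroup : ∀ n l → n + (1ℤ + l) ≡ (1ℤ + n) + l * 1ℤ
      regroup = solve-∀

  module WeightDistribution (ν : ℕ) {𝒞 : Code (suc (suc ν ℕ.+ suc ν))} (diamond : IsDiamond 𝒞)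
                            (l : ℤ) (nA₀≡1+l : + (suc ν ℕ.+ suc ν) * + A 𝒞 0 ≡ 1ℤ + l) where

    private
      N n : ℕ
      N = suc ν
      n = N ℕ.+ N

    formula : ∀ i → + n * + A 𝒞 i ≡ + ((n ℕ.+ 1) C i) + l * altBinomial N i
    formula i = trans (weight-formula N diamond l nA₀≡1+l i)
                      (cong (λ m → + (m C i) + l * altBinomial N i) (ℕ.+-comm 1 n))

    even-weight : ∀ i → i % 2 ≡ 0 → 0 ℕ.< i → + n * + A 𝒞 i ≡ + ((n ℕ.+ 1) C i) + l * (Δ ν (i ∸ 1) + Δ ν i)
    even-weight (suc (suc x)) x-even _ =
      trans (formula (suc (suc x))) (cong (λ e → + ((n ℕ.+ 1) C suc (suc x)) + l * e) (altBinomial≡Δ+Δ ν x x-even))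

    odd-weight : ∀ i → i % 2 ≡ 1 → 1 ℕ.< i → + n * + A 𝒞 i ≡ + ((n ℕ.+ 1) C i) + l * (Δ ν (i ∸ 1) + Δ ν (i ∸ 2))
    odd-weight 1                   _          (s≤s ())
    odd-weight (suc (suc (suc x))) [1+x]%2≡1 _ = trans (formula (suc (suc (suc x))))
      (cong (λ e → + ((n ℕ.+ 1) C suc (suc (suc x))) + l * e) (begin
        altBinomial N (suc (suc (suc x)))  ≡⟨ altBinomial-odd≡even N x x-even ⟩
        altBinomial N (suc (suc x))        ≡⟨ altBinomial≡Δ+Δ ν x x-even ⟩
        Δ ν (suc x) + Δ ν (suc (suc x))    ≡⟨ +-comm (Δ ν (suc x)) (Δ ν (suc (suc x))) ⟩
        Δ ν (suc (suc x)) + Δ ν (suc x)    ∎))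
      where
      x-even : x % 2 ≡ 0
      x-even = [1+n]%2≡1⇒n%2≡0 x [1+x]%2≡1

    cancel-n : ∀ {a b} → + n * + a ≡ + n * + b → a ≡ b
    cancel-n {a} {b} eq = +-injective (*-cancelˡ-≡ (+ n) (+ a) (+ b) eq)

    odd-symmetric : (-1ℤ) ^ N ≡ 1ℤ → ∀ i → i % 2 ≡ 1 → i ≤ n → A 𝒞 i ≡ A 𝒞 (n ℕ.+ 1 ∸ i)
    odd-symmetric [-1]^N≡1 i i-odd i≤n = cancel-n (begin
      + n * + A 𝒞 i                                                    ≡⟨ formula i ⟩
      + ((n ℕ.+ 1) C i) + l * altBinomial N i
        ≡⟨ cong₂ (λ c e → + c + l * e) (nCk≡nC[n∸k] (ℕ.m≤n⇒m≤n+o 1 i≤n))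
                                        (sym (altBinomial-reflect N [-1]^N≡1 i i-odd i≤n)) ⟩
      + ((n ℕ.+ 1) C (n ℕ.+ 1 ∸ i)) + l * altBinomial N (suc n ∸ i)
        ≡⟨ cong (λ m → + ((n ℕ.+ 1) C (n ℕ.+ 1 ∸ i)) + l * altBinomial N (m ∸ i)) (ℕ.+-comm 1 n) ⟩
      + ((n ℕ.+ 1) C (n ℕ.+ 1 ∸ i)) + l * altBinomial N (n ℕ.+ 1 ∸ i)  ≡⟨ formula (n ℕ.+ 1 ∸ i) ⟨
      + n * + A 𝒞 (n ℕ.+ 1 ∸ i)                                        ∎)

    top-weight : (-1ℤ) ^ N ≡ 1ℤ → + n * + A 𝒞 (n ℕ.+ 1) ≡ 1ℤ + l
    top-weight [-1]^N≡1 = begin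
      + n * + A 𝒞 (n ℕ.+ 1)                    ≡⟨ formula (n ℕ.+ 1) ⟩
      + ((n ℕ.+ 1) C (n ℕ.+ 1)) + l * altBinomial N (n ℕ.+ 1)
        ≡⟨ cong₂ (λ c e → + c + l * e) (nCn≡1 (n ℕ.+ 1))
                 (trans (cong (altBinomial N) (ℕ.+-comm n 1)) (altBinomial[2N+1]≡1 N [-1]^N≡1)) ⟩
      1ℤ + l * 1ℤ                              ≡⟨ cong (_+_ 1ℤ) (*-identityʳ l) ⟩
      1ℤ + l                                   ∎

    next-to-top-weight : (-1ℤ) ^ N ≡ 1ℤ → + n * + A 𝒞 n ≡ + (n ℕ.+ 1) + l
    next-to-top-weight [-1]^N≡1 = begin
      + n * + A 𝒞 n                          ≡⟨ formula n ⟩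
      + ((n ℕ.+ 1) C n) + l * altBinomial N n
        ≡⟨ cong₂ (λ c e → + c + l * e) [n+1]Cn≡n+1 (altBinomial[2N]≡1 N [-1]^N≡1) ⟩
      + (n ℕ.+ 1) + l * 1ℤ                   ≡⟨ cong (_+_ (+ (n ℕ.+ 1))) (*-identityʳ l) ⟩
      + (n ℕ.+ 1) + l                        ∎
      where
      [n+1]Cn≡n+1 : (n ℕ.+ 1) C n ≡ n ℕ.+ 1
      [n+1]Cn≡n+1 = begin
        (n ℕ.+ 1) C n                 ≡⟨ nCk≡nC[n∸k] (ℕ.m≤m+n n 1) ⟩
        (n ℕ.+ 1) C (n ℕ.+ 1 ∸ n)     ≡⟨ cong ((n ℕ.+ 1) C_) (ℕ.m+n∸m≡n n 1) ⟩
        (n ℕ.+ 1) C 1                 ≡⟨ nC1≡n (n ℕ.+ 1) ⟩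
        n ℕ.+ 1                       ∎

open import Data.Nat using (ℕ; suc; _+_; _*_; _∸_; _^_; _≤_; _<_; _%_; s≤s)
import Data.Nat.Properties as ℕ
open import Data.Nat.Combinatorics using (_C_)
open import Data.Nat.Tactic.RingSolver using (solve-∀)
open import Data.Integer as ℤ using (ℤ; +_; 1ℤ; -1ℤ)
import Data.Integer.Properties as ℤ
open import Data.Product using (_×_; _,_)
open import Relation.Binary.PropositionalEquality

open HammingCube using (A-zero; A₁≡1+A₀)
open WeightEnumerator using (module WeightDistribution)

zeroed-diamond-weights : ∀ n ν → n ≡ suc ν + suc ν → (-1ℤ) ℤ.^ suc ν ≡ 1ℤ →
  (𝒞 : Code (suc n)) → IsDiamond 𝒞 → Zeroed 𝒞 →
    (A 𝒞 0 ≡ 1) × (A 𝒞 (n + 1) ≡ 1) × (A 𝒞 1 ≡ 2) × (A 𝒞 n ≡ 2)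
    × (∀ i → i % 2 ≡ 0 → 0 < i → i ≤ n + 1 →
         + n ℤ.* + (A 𝒞 i)
           ≡ + ((n + 1) C i) ℤ.+ + (n ∸ 1) ℤ.* (Δ ν (i ∸ 1) ℤ.+ Δ ν i))
    × (∀ i → i % 2 ≡ 1 → 1 < i → i ≤ n →
         (A 𝒞 i ≡ A 𝒞 (n + 1 ∸ i))
         × (+ n ℤ.* + (A 𝒞 i)
             ≡ + ((n + 1) C i) ℤ.+ + (n ∸ 1) ℤ.* (Δ ν (i ∸ 1) ℤ.+ Δ ν (i ∸ 2))))
zeroed-diamond-weights _ ν refl [-1]^N≡1 𝒞 diamond zeroed =
    A₀≡1
  , cancel-n (trans (top-weight [-1]^N≡1) (sym (ℤ.*-identityʳ (+ n))))
  , trans (A₁≡1+A₀ diamond) (cong suc A₀≡1)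
  , cancel-n (trans (next-to-top-weight [-1]^N≡1) [n+1]+[n∸1]≡n*2)
  , (λ i i-even 0<i _ → even-weight i i-even 0<i)
  , (λ i i-odd 1<i i≤n → odd-symmetric [-1]^N≡1 i i-odd i≤n , odd-weight i i-odd 1<i)
  where
  n : ℕ
  n = suc ν + suc ν
  A₀≡1 : A 𝒞 0 ≡ 1
  A₀≡1 = trans (A-zero 𝒞) (cong b2n zeroed)
  open WeightDistribution ν diamond (+ (n ∸ 1)) (trans (cong (λ a → + n ℤ.* + a) A₀≡1) (ℤ.*-identityʳ (+ n)))
  [n+1]+[n∸1]≡n*2 : + (n + 1) ℤ.+ + (n ∸ 1) ≡ + n ℤ.* + 2
  [n+1]+[n∸1]≡n*2 = trans (sym (ℤ.pos-+ (n + 1) (n ∸ 1))) (trans (cong +_ (arith (ν + suc ν))) (ℤ.pos-* n 2))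
    where
    arith : ∀ m → suc m + 1 + m ≡ suc m * 2
    arith = solve-∀

nonzeroed-diamond-weights : ∀ n ν → n ≡ suc ν + suc ν →
  (𝒞 : Code (suc n)) → IsDiamond 𝒞 → ¬Zeroed 𝒞 →
    (A 𝒞 0 ≡ 0) × (A 𝒞 1 ≡ 1)
    × (∀ i → i % 2 ≡ 0 → 0 < i → i ≤ n + 1 →
         + n ℤ.* + (A 𝒞 i)
           ≡ + ((n + 1) C i) ℤ.- (Δ ν i ℤ.+ Δ ν (i ∸ 1)))
    × (∀ i → i % 2 ≡ 1 → 1 < i → i ≤ n + 1 →
         + n ℤ.* + (A 𝒞 i)
           ≡ + ((n + 1) C i) ℤ.- (Δ ν (i ∸ 1) ℤ.+ Δ ν (i ∸ 2)))
nonzeroed-diamond-weights _ ν refl 𝒞 diamond nonzeroed =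
    A₀≡0
  , trans (A₁≡1+A₀ diamond) (cong suc A₀≡0)
  , (λ i i-even 0<i _ → trans (even-weight i i-even 0<i) (cong (ℤ._+_ (+ ((n + 1) C i)))
       (trans (ℤ.-1*i≡-i (Δ ν (i ∸ 1) ℤ.+ Δ ν i)) (cong ℤ.-_ (ℤ.+-comm (Δ ν (i ∸ 1)) (Δ ν i))))))
  , (λ i i-odd 1<i _ → trans (odd-weight i i-odd 1<i)
       (cong (ℤ._+_ (+ ((n + 1) C i))) (ℤ.-1*i≡-i (Δ ν (i ∸ 1) ℤ.+ Δ ν (i ∸ 2)))))
  where
  n : ℕ
  n = suc ν + suc ν
  A₀≡0 : A 𝒞 0 ≡ 0
  A₀≡0 = trans (A-zero 𝒞) (cong b2n nonzeroed)
  open WeightDistribution ν diamond -1ℤ (trans (cong (λ a → + n ℤ.* + a) A₀≡0) (ℤ.*-zeroʳ (+ n)))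

mainTheorem8 :
  (r : ℕ) → 2 ≤ r →
  let n = 2 ^ r
      M = 2 ^ (n ∸ r)
      ν = 2 ^ (r ∸ 1) ∸ 1
  in
  ((𝒞 : Code (suc n)) → IsDiamond 𝒞 → Zeroed 𝒞 → size 𝒞 ≡ 2 * M →
    (A 𝒞 0 ≡ 1) × (A 𝒞 (n + 1) ≡ 1) × (A 𝒞 1 ≡ 2) × (A 𝒞 n ≡ 2)
    × (∀ i → i % 2 ≡ 0 → 0 < i → i ≤ n + 1 →
         + n ℤ.* + (A 𝒞 i)
           ≡ + ((n + 1) C i) ℤ.+ + (n ∸ 1) ℤ.* (Δ ν (i ∸ 1) ℤ.+ Δ ν i))
    × (∀ i → i % 2 ≡ 1 → 1 < i → i ≤ n →
         (A 𝒞 i ≡ A 𝒞 (n + 1 ∸ i))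
         × (+ n ℤ.* + (A 𝒞 i)
             ≡ + ((n + 1) C i) ℤ.+ + (n ∸ 1) ℤ.* (Δ ν (i ∸ 1) ℤ.+ Δ ν (i ∸ 2)))))
  ×
  ((𝒞 : Code (suc n)) → IsDiamond 𝒞 → ¬Zeroed 𝒞 → size 𝒞 ≡ 2 * M →
    (A 𝒞 0 ≡ 0) × (A 𝒞 1 ≡ 1)
    × (∀ i → i % 2 ≡ 0 → 0 < i → i ≤ n + 1 →
         + n ℤ.* + (A 𝒞 i)
           ≡ + ((n + 1) C i) ℤ.- (Δ ν i ℤ.+ Δ ν (i ∸ 1)))
    × (∀ i → i % 2 ≡ 1 → 1 < i → i ≤ n + 1 →
         + n ℤ.* + (A 𝒞 i)
           ≡ + ((n + 1) C i) ℤ.- (Δ ν (i ∸ 1) ℤ.+ Δ ν (i ∸ 2))))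
mainTheorem8 1             (s≤s ())
mainTheorem8 (suc (suc r)) _ =
    (λ 𝒞 diamond zeroed _ → zeroed-diamond-weights n ν n≡2N [-1]^N≡1 𝒞 diamond zeroed)
  , (λ 𝒞 diamond nonzeroed _ → nonzeroed-diamond-weights n ν n≡2N 𝒞 diamond nonzeroed)
  where
  n ν : ℕ
  n = 2 ^ suc (suc r)
  ν = 2 ^ suc r ∸ 1
  N≡2^[1+r] : suc ν ≡ 2 ^ suc r
  N≡2^[1+r] = ℕ.suc-pred (2 ^ suc r) {{ℕ.m^n≢0 2 (suc r)}}
  n≡2N : n ≡ suc ν + suc ν
  n≡2N = trans (cong (_+_ (2 ^ suc r)) (ℕ.+-identityʳ (2 ^ suc r))) (cong₂ _+_ (sym N≡2^[1+r]) (sym N≡2^[1+r]))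
  [-1]^N≡1 : (-1ℤ) ℤ.^ suc ν ≡ 1ℤ
  [-1]^N≡1 = trans (cong (-1ℤ ℤ.^_) N≡2^[1+r]) (trans (sym (ℤ.^-*-assoc -1ℤ 2 (2 ^ r))) (ℤ.^-zeroˡ (2 ^ r)))
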